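{- Let $q$ be a prime power and $n,k_1,k_2,t$ positive integers with $n\geq k_1+k_2+t+3$, $k_1\geq k_2\geq t+1$, and $t+2\leq k_2\leq 2t$. Then $g_5(k_1,k_2,n,t)g_2(k_2,n,t)<g_3(k_1,k_2,n,t)$, where $g_5(k,\ell,n,t)={\ell-t+1\brack 1}{n-t-1\brack k-t-1}-q^{(\ell-t-1)(k-t-2)+1}{n-\ell-1\brack k-t-2}{\ell+1-t\brack 2}$, $g_2(\ell,n,t)={n-t\brack \ell-t}+q^{\ell+1-t}{t\brack 1}$, and $g_3(k,\ell,n,t)={n-t-1\brack k-t-1}\left(q^{\ell-t}{t+1\brack 1}{n-t-1\brack \ell-t}+{n-t-1\brack \ell-t-1}\right)$.
   Context: Gaussian binomial coefficient: ${a\brack b}=\prod_{0\leq i<b}\frac{q^{a-i}-1}{q^{b-i}-1}$ for positive integers $a,b$, with ${a\brack 0}=1$ and ${a\brack c}=0$ for negative $c$. -}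

module Defs where

open import Data.Nat using (ℕ; zero; suc; _*_; _∸_; _^_)
open import Data.Nat.DivMod using (_/_)
open import Data.Nat.Primality using (Prime)
open import Data.Product using (∃; ∃-syntax; _×_)
open import Relation.Binary.PropositionalEquality using (_≡_)

IsPrimePower : ℕ → Set
IsPrimePower q = ∃[ p ] ∃[ m ] (Prime p × q ≡ p ^ suc m)

prodFrom : ℕ → ℕ → ℕ → ℕ
prodFrom q a zero = 1
prodFrom q a (suc b) = prodFrom q a b * (q ^ (a ∸ b) ∸ 1)

-- exact natural division (returns 0 on a zero divisor, which never
-- happens for q ≥ 2 since every factor q^(b-i) - 1 has b - i ≥ 1)
divN : ℕ → ℕ → ℕ
divN m zero = 0
divN m (suc d) = m / suc d

-- Gaussian binomial coefficient [a b]_q = ∏_{0≤i<b} (q^(a-i)-1)/(q^(b-i)-1),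
-- with [a 0] = 1 (empty product).
gauss : ℕ → ℕ → ℕ → ℕ
gauss q a b = divN (prodFrom q a b) (prodFrom q b b)

-- Write [a,b] for the Gaussian coefficient and put s = k₂ − t, j = k₁ − t − 1, r = n − k₂ − 1,
-- m = n − t − 1 = s + r (in the code s' = s − 1 and j' = j − 1).  By q-Pascal, [m+1,s] = [m,s−1] + q^s[m,s],
-- and [s+1,1] = 1 + q[s,1] ≤ [t+1,1]; expanding g₅g₂ therefore gives at most g₃ plus the correction [m,j]·W with
-- W = q[s,1][m,s−1] + [s+1,1]q^(s+1)[t,1], which has to be beaten by q^((s−1)(j−1)) [r,j−1] · q^(s+1)[s+1,2][m,s],
-- a part of the subtracted term of g₅ times g₂.  Peeling off factors gives [m,j] ≤ q^((s−1)(j−1)) [r,j−1][m,1],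
-- so it suffices that [m,1]·W is less than the main term q^(s+1)[s+1,2][m,s]; its two summands are at most 15/16
-- and less than 1/16 of it.  Via the absorption identity [a,b+1](q^(b+1) − 1) = [a,b](q^(a−b) − 1) all these
-- estimates become elementary inequalities between powers of q ≥ 2, using m ≥ t + 7 and m − s ≥ 2.
module Submission where

open import Defs
open import Data.Nat using (ℕ; _≤_; _+_; _∸_; _^_; _*_)
open import Data.Integer using (ℤ; +_; _-_) renaming (_*_ to _*ℤ_; _+_ to _+ℤ_; _<_ to _<ℤ_)
open import Data.Integer using (_⊖_; -_)
import Data.Integer.Properties as ℤP
open import Data.Nat using (zero; suc; _<_; s≤s; z≤n; >-nonZero; nonTrivial⇒n>1)
open import Data.Nat.DivMod using (m*n/n≡m)
open import Data.Nat.Primality using (prime⇒nonTrivial; prime⇒nonZero)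
open import Data.Nat.Properties
open import Algebra.Properties.CommutativeSemigroup *-commutativeSemigroup using (xy∙z≈xz∙y; x∙yz≈y∙xz)
open import Data.Nat.Tactic.RingSolver using (solve-∀)
open import Data.Product using (_,_)
open import Data.Sum using (inj₁; inj₂)
open import Relation.Binary.PropositionalEquality

m<n⇒n∸m≡1+[n∸1+m] : ∀ {m n} → m < n → n ∸ m ≡ suc (n ∸ suc m)
m<n⇒n∸m≡1+[n∸1+m] {zero}  {suc n} _         = refl
m<n⇒n∸m≡1+[n∸1+m] {suc m} {suc n} (s≤s m<n) = m<n⇒n∸m≡1+[n∸1+m] m<n

+a-+b*+g<+c : ∀ {a b c g} → a * g < c + b * g → (+ a - + b) *ℤ + g <ℤ + c
+a-+b*+g<+c {a} {b} {c} {g} ag<c+bg = subst₂ _<ℤ_ (sym [+a-+b]*+g≡ag⊖bg) [c+bg]⊖bg≡+c (ℤP.⊖-monoˡ-< (b * g) ag<c+bg)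
  where
  [+a-+b]*+g≡ag⊖bg : (+ a - + b) *ℤ + g ≡ (a * g) ⊖ (b * g)
  [+a-+b]*+g≡ag⊖bg = begin
    (+ a - + b) *ℤ + g             ≡⟨ ℤP.*-distribʳ-+ (+ g) (+ a) (- + b) ⟩
    + a *ℤ + g +ℤ - (+ b) *ℤ + g   ≡⟨ cong₂ _+ℤ_ (sym (ℤP.pos-* a g)) (sym (ℤP.neg-distribˡ-* (+ b) (+ g))) ⟩
    + (a * g) +ℤ - (+ b *ℤ + g)    ≡⟨ cong (λ x → + (a * g) +ℤ - x) (sym (ℤP.pos-* b g)) ⟩
    + (a * g) - + (b * g)          ≡⟨ ℤP.[+m]-[+n]≡m⊖n (a * g) (b * g) ⟩
    (a * g) ⊖ (b * g)              ∎
    where open ≡-Reasoning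
  [c+bg]⊖bg≡+c : (c + b * g) ⊖ (b * g) ≡ + c
  [c+bg]⊖bg≡+c = trans (ℤP.⊖-≥ (m≤n+m (b * g) c)) (cong +_ (m+n∸n≡m c (b * g)))

-- q ≥ 2 is written q = 2 + p, so that the polynomial estimates in q below are ring identities in p.
module Gaussian (p : ℕ) where

  q : ℕ
  q = 2 + p

  δ : ℕ → ℕ
  δ x = q ^ x ∸ 1

  q^≡1+δ : ∀ n → q ^ n ≡ suc (δ n)
  q^≡1+δ n with q ^ n | m^n>0 q n
  ... | suc _ | _ = refl

  δ-+ : ∀ k n → δ (k + n) ≡ q ^ k * δ n + δ k
  δ-+ k n = suc-injective (begin
      suc (δ (k + n))              ≡⟨ q^≡1+δ (k + n) ⟨
      q ^ (k + n)                  ≡⟨ ^-distribˡ-+-* q k n ⟩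
      q ^ k * q ^ n                ≡⟨ cong₂ _*_ (q^≡1+δ k) (q^≡1+δ n) ⟩
      suc (δ k) * suc (δ n)        ≡⟨ expand (δ k) (δ n) ⟩
      suc (suc (δ k) * δ n + δ k)  ≡⟨ cong (λ x → suc (x * δ n + δ k)) (q^≡1+δ k) ⟨
      suc (q ^ k * δ n + δ k)      ∎)
    where
    open ≡-Reasoning
    expand : ∀ a b → suc a * suc b ≡ suc (suc a * b + a)
    expand = solve-∀

  δ1≡1+p : δ 1 ≡ suc p
  δ1≡1+p = cong (λ x → suc x ∸ 1) (*-identityʳ (suc p))

  δ-suc : ∀ n → δ (suc n) ≡ q * δ n + suc p
  δ-suc n = trans (δ-+ 1 n) (cong₂ (λ x y → x * δ n + y) (*-identityʳ q) δ1≡1+p)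

  0<δ-suc : ∀ n → 0 < δ (suc n)
  0<δ-suc n = subst (0 <_) (sym (δ-suc n)) (≤-trans (s≤s z≤n) (m≤n+m (suc p) (q * δ n)))

  q*δ≤δ-suc : ∀ n → q * δ n ≤ δ (suc n)
  q*δ≤δ-suc n = subst (q * δ n ≤_) (sym (δ-suc n)) (m≤m+n (q * δ n) (suc p))

  δ-mono : ∀ {m n} → m ≤ n → δ m ≤ δ n
  δ-mono m≤n = ∸-monoˡ-≤ 1 (^-monoʳ-≤ q m≤n)

  δ-+≤q^*δ : ∀ k n → δ (k + suc n) ≤ q ^ suc k * δ (suc n)
  δ-+≤q^*δ k n = begin
      δ (k + suc n)             ≡⟨ δ-+ k (suc n) ⟩
      X + δ k                   ≤⟨ +-monoʳ-≤ X δk≤X ⟩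
      X + X                     ≤⟨ +-monoʳ-≤ X (m≤m+n X (p * X)) ⟩
      q * X                     ≡⟨ *-assoc q (q ^ k) (δ (suc n)) ⟨
      q ^ suc k * δ (suc n)     ∎
    where
    open ≤-Reasoning
    X = q ^ k * δ (suc n)
    δk≤X : δ k ≤ X
    δk≤X = begin
      δ k                 ≤⟨ m∸n≤m (q ^ k) 1 ⟩
      q ^ k               ≡⟨ *-identityʳ (q ^ k) ⟨
      q ^ k * 1           ≤⟨ *-monoʳ-≤ (q ^ k) (0<δ-suc n) ⟩
      X                   ∎

  qbin : ℕ → ℕ → ℕ
  qbin zero    zero    = 1
  qbin zero    (suc b) = 0
  qbin (suc a) zero    = 1
  qbin (suc a) (suc b) = qbin a b + q ^ suc b * qbin a (suc b)

  prodFrom-suc : ∀ a b → prodFrom q (suc a) (suc b) ≡ δ (suc a) * prodFrom q a b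
  prodFrom-suc a zero    = trans (*-identityˡ _) (sym (*-identityʳ _))
  prodFrom-suc a (suc b) = trans (cong (_* δ (a ∸ b)) (prodFrom-suc a b)) (*-assoc (δ (suc a)) _ _)

  prodFrom-< : ∀ {a b} → a < b → prodFrom q a b ≡ 0
  prodFrom-< {a} {suc b} (s≤s a≤b) with m≤n⇒m<n∨m≡n a≤b
  ... | inj₁ a<b  = cong (_* δ (a ∸ b)) (prodFrom-< a<b)
  ... | inj₂ refl = trans (cong (λ x → prodFrom q a a * δ x) (n∸n≡0 a)) (*-zeroʳ (prodFrom q a a))

  qbin*prodFrom : ∀ a b → qbin a b * prodFrom q b b ≡ prodFrom q a b
  qbin*prodFrom zero    zero    = refl
  qbin*prodFrom zero    (suc b) = sym (prodFrom-< {0} {suc b} (s≤s z≤n))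
  qbin*prodFrom (suc a) zero    = refl
  qbin*prodFrom (suc a) (suc b) = begin
      (qbin a b + Q * qbin a (suc b)) * prodFrom q (suc b) (suc b)
    ≡⟨ cong ((qbin a b + Q * qbin a (suc b)) *_) (prodFrom-suc b b) ⟩
      (qbin a b + Q * qbin a (suc b)) * (δ (suc b) * P)
    ≡⟨ distribute (qbin a b) Q (qbin a (suc b)) (δ (suc b)) P ⟩
      δ (suc b) * (qbin a b * P) + Q * (qbin a (suc b) * (δ (suc b) * P))
    ≡⟨ cong₂ (λ x y → δ (suc b) * x + Q * y) (qbin*prodFrom a b)
             (trans (cong (qbin a (suc b) *_) (sym (prodFrom-suc b b))) (qbin*prodFrom a (suc b))) ⟩
      δ (suc b) * R + Q * (R * δ (a ∸ b))
    ≡⟨ collect (δ (suc b)) R Q (δ (a ∸ b)) ⟩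
      R * (Q * δ (a ∸ b) + δ (suc b))
    ≡⟨ last-factor ⟩
      prodFrom q (suc a) (suc b)
    ∎
    where
    open ≡-Reasoning
    Q = q ^ suc b
    P = prodFrom q b b
    R = prodFrom q a b
    distribute : ∀ x y z u v → (x + y * z) * (u * v) ≡ u * (x * v) + y * (z * (u * v))
    distribute = solve-∀
    collect : ∀ x y z u → x * y + z * (y * u) ≡ y * (z * u + x)
    collect = solve-∀
    last-factor : R * (Q * δ (a ∸ b) + δ (suc b)) ≡ prodFrom q (suc a) (suc b)
    last-factor with ≤-<-connex b a
    ... | inj₁ b≤a = begin
        R * (Q * δ (a ∸ b) + δ (suc b))   ≡⟨ cong (R *_) (δ-+ (suc b) (a ∸ b)) ⟨
        R * δ (suc b + (a ∸ b))           ≡⟨ cong (λ x → R * δ (suc x)) (m+[n∸m]≡n b≤a) ⟩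
        R * δ (suc a)                     ≡⟨ *-comm R (δ (suc a)) ⟩
        δ (suc a) * R                     ≡⟨ prodFrom-suc a b ⟨
        prodFrom q (suc a) (suc b)        ∎
    ... | inj₂ a<b = begin
        R * (Q * δ (a ∸ b) + δ (suc b))   ≡⟨ cong (_* (Q * δ (a ∸ b) + δ (suc b))) (prodFrom-< a<b) ⟩
        0                                 ≡⟨ *-zeroʳ (δ (suc a)) ⟨
        δ (suc a) * 0                     ≡⟨ cong (δ (suc a) *_) (prodFrom-< a<b) ⟨
        δ (suc a) * R                     ≡⟨ prodFrom-suc a b ⟨
        prodFrom q (suc a) (suc b)        ∎

  0<prodFrom : ∀ {a b} → b ≤ a → 0 < prodFrom q a b
  0<prodFrom {a} {zero}  _    = s≤s z≤n
  0<prodFrom {a} {suc b} b<a  =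
    *-mono-< (0<prodFrom (<⇒≤ b<a)) (subst (λ x → 0 < δ x) (sym (m<n⇒n∸m≡1+[n∸1+m] b<a)) (0<δ-suc (a ∸ suc b)))

  gauss≡qbin : ∀ a b → gauss q a b ≡ qbin a b
  gauss≡qbin a b = begin
      divN (prodFrom q a b) P             ≡⟨ cong (λ x → divN x P) (qbin*prodFrom a b) ⟨
      divN (qbin a b * P) P               ≡⟨ divN-* (qbin a b) (0<prodFrom {b} ≤-refl) ⟩
      qbin a b                            ∎
    where
    open ≡-Reasoning
    P = prodFrom q b b
    divN-* : ∀ x {d} → 0 < d → divN (x * d) d ≡ x
    divN-* x {suc d} _ = m*n/n≡m x (suc d)

  qbin-absorb : ∀ a b → qbin a (suc b) * δ (suc b) ≡ qbin a b * δ (a ∸ b)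
  qbin-absorb a b = *-cancelʳ-≡ _ _ P {{>-nonZero (0<prodFrom {b} ≤-refl)}} (begin
      qbin a (suc b) * δ (suc b) * P    ≡⟨ *-assoc (qbin a (suc b)) (δ (suc b)) P ⟩
      qbin a (suc b) * (δ (suc b) * P)  ≡⟨ cong (qbin a (suc b) *_) (prodFrom-suc b b) ⟨
      qbin a (suc b) * prodFrom q (suc b) (suc b) ≡⟨ qbin*prodFrom a (suc b) ⟩
      prodFrom q a b * δ (a ∸ b)        ≡⟨ cong (_* δ (a ∸ b)) (qbin*prodFrom a b) ⟨
      qbin a b * P * δ (a ∸ b)          ≡⟨ xy∙z≈xz∙y (qbin a b) P (δ (a ∸ b)) ⟩
      qbin a b * δ (a ∸ b) * P          ∎)
    where
    open ≡-Reasoning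
    P = prodFrom q b b

  qbin-0 : ∀ a → qbin a 0 ≡ 1
  qbin-0 zero    = refl
  qbin-0 (suc a) = refl

  qbin-1*δ1 : ∀ a → qbin a 1 * δ 1 ≡ δ a
  qbin-1*δ1 a = trans (qbin-absorb a 0) (trans (cong (_* δ a) (qbin-0 a)) (*-identityˡ (δ a)))

  qbin-suc-1 : ∀ a → qbin (suc a) 1 ≡ suc (q * qbin a 1)
  qbin-suc-1 a = cong₂ (λ x y → x + y * qbin a 1) (qbin-0 a) (*-identityʳ q)

  0<qbin : ∀ {a b} → b ≤ a → 0 < qbin a b
  0<qbin {zero}  {zero}  _         = s≤s z≤n
  0<qbin {suc a} {zero}  _         = s≤s z≤n
  0<qbin {suc a} {suc b} (s≤s b≤a) = ≤-trans (0<qbin b≤a) (m≤m+n (qbin a b) _)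

  qbin-1≤δ : ∀ a → qbin a 1 ≤ δ a
  qbin-1≤δ a = begin
      qbin a 1          ≤⟨ m≤m*n (qbin a 1) (δ 1) {{>-nonZero (0<δ-suc 0)}} ⟩
      qbin a 1 * δ 1    ≡⟨ qbin-1*δ1 a ⟩
      δ a               ∎
    where open ≤-Reasoning

  qbin-1-mono : ∀ {a b} → a ≤ b → qbin a 1 ≤ qbin b 1
  qbin-1-mono {a} {b} a≤b = *-cancelʳ-≤ (qbin a 1) (qbin b 1) (δ 1) {{>-nonZero (0<δ-suc 0)}}
    (subst₂ _≤_ (sym (qbin-1*δ1 a)) (sym (qbin-1*δ1 b)) (δ-mono a≤b))

  qbin-≤-suc : ∀ {m b} → suc b + b ≤ m → qbin m b ≤ qbin m (suc b)
  qbin-≤-suc {m} {b} le = *-cancelʳ-≤ _ _ (δ (suc b)) {{>-nonZero (0<δ-suc b)}} (begin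
      qbin m b * δ (suc b)       ≤⟨ *-monoʳ-≤ (qbin m b) (δ-mono (m+n≤o⇒m≤o∸n (suc b) le)) ⟩
      qbin m b * δ (m ∸ b)       ≡⟨ qbin-absorb m b ⟨
      qbin m (suc b) * δ (suc b) ∎)
    where open ≤-Reasoning

  qbin-monoʳ-≤ : ∀ {m b c} → b ≤ c → c + c ≤ suc m → qbin m b ≤ qbin m c
  qbin-monoʳ-≤ {c = zero}  z≤n _ = ≤-refl
  qbin-monoʳ-≤ {m} {b} {suc c} b≤1+c le with m≤n⇒m<n∨m≡n b≤1+c
  ... | inj₂ refl      = ≤-refl
  ... | inj₁ (s≤s b≤c) = ≤-trans (qbin-monoʳ-≤ b≤c (≤-trans (+-mono-≤ (n≤1+n c) (n≤1+n c)) le))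
                                 (qbin-≤-suc (subst (_≤ m) (+-suc c c) (≤-pred le)))

  qbin-+≤ : ∀ k r i → i < r → qbin (suc k + r) (suc i) ≤ q ^ (k * i) * qbin r i * qbin (suc k + r) 1
  qbin-+≤ k r zero    _ rewrite *-zeroʳ k | qbin-0 r = ≤-reflexive (sym (+-identityʳ _))
  qbin-+≤ k r (suc i) 2+i≤r =
    *-cancelʳ-≤ _ _ (δ (2 + i) * δ (1 + i)) {{>-nonZero (*-mono-< (0<δ-suc (1 + i)) (0<δ-suc i))}} (begin
      qbin m (2 + i) * (δ (2 + i) * δ (1 + i))
    ≡⟨ *-assoc (qbin m (2 + i)) _ _ ⟨
      qbin m (2 + i) * δ (2 + i) * δ (1 + i)
    ≡⟨ cong (_* δ (1 + i)) (trans (qbin-absorb m (1 + i)) (cong (λ x → qbin m (1 + i) * δ x) m∸[1+i]≡k+[1+a])) ⟩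
      qbin m (1 + i) * δ (k + suc a) * δ (1 + i)
    ≤⟨ *-monoˡ-≤ (δ (1 + i)) (*-mono-≤ (qbin-+≤ k r i (<⇒≤ 2+i≤r)) (δ-+≤q^*δ k a)) ⟩
      W * (q ^ suc k * δ (suc a)) * δ (1 + i)
    ≡⟨ rearrange q (q ^ k) (q ^ (k * i)) (qbin r i) (δ (suc a)) (qbin m 1) (δ (1 + i)) ⟩
      q ^ k * q ^ (k * i) * (qbin r i * δ (suc a)) * qbin m 1 * (q * δ (1 + i))
    ≡⟨ cong₂ (λ x y → x * y * qbin m 1 * (q * δ (1 + i))) q^k*q^ki≡q^k[1+i] qbin-r-absorb ⟩
      q ^ (k * suc i) * (qbin r (1 + i) * δ (1 + i)) * qbin m 1 * (q * δ (1 + i))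
    ≤⟨ *-monoʳ-≤ (q ^ (k * suc i) * (qbin r (1 + i) * δ (1 + i)) * qbin m 1) (q*δ≤δ-suc (1 + i)) ⟩
      q ^ (k * suc i) * (qbin r (1 + i) * δ (1 + i)) * qbin m 1 * δ (2 + i)
    ≡⟨ regroup (q ^ (k * suc i)) (qbin r (1 + i)) (δ (1 + i)) (qbin m 1) (δ (2 + i)) ⟩
      q ^ (k * suc i) * qbin r (1 + i) * qbin m 1 * (δ (2 + i) * δ (1 + i))
    ∎)
    where
    open ≤-Reasoning
    m = suc k + r
    a = r ∸ suc i
    W = q ^ (k * i) * qbin r i * qbin m 1
    r∸i≡1+a : r ∸ i ≡ suc a
    r∸i≡1+a = m<n⇒n∸m≡1+[n∸1+m] (<⇒≤ 2+i≤r)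
    m∸[1+i]≡k+[1+a] : m ∸ suc i ≡ k + suc a
    m∸[1+i]≡k+[1+a] = trans (+-∸-assoc k (<⇒≤ (<⇒≤ 2+i≤r))) (cong (λ x → k + x) r∸i≡1+a)
    qbin-r-absorb : qbin r i * δ (suc a) ≡ qbin r (1 + i) * δ (1 + i)
    qbin-r-absorb = trans (cong (λ x → qbin r i * δ x) (sym r∸i≡1+a)) (sym (qbin-absorb r i))
    q^k*q^ki≡q^k[1+i] : q ^ k * q ^ (k * i) ≡ q ^ (k * suc i)
    q^k*q^ki≡q^k[1+i] = trans (sym (^-distribˡ-+-* q k (k * i))) (cong (q ^_) (sym (*-suc k i)))
    rearrange : ∀ c x y z u v w → y * z * v * (c * x * u) * w ≡ x * y * (z * u) * v * (c * w)
    rearrange = solve-∀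
    regroup : ∀ x y z u v → x * (y * z) * u * v ≡ x * y * u * (v * z)
    regroup = solve-∀

  δ2≡[1+q]*δ1 : δ 2 ≡ suc q * δ 1
  δ2≡[1+q]*δ1 = trans (δ-suc 1) (trans (+-comm (q * δ 1) (suc p)) (cong (_+ q * δ 1) (sym δ1≡1+p)))

  16[1+q]q^w≤15q²δw : ∀ {w} → 3 ≤ w → 16 * suc q * q ^ w ≤ 15 * (q * q) * δ w
  16[1+q]q^w≤15q²δw {w} 3≤w = begin
      16 * suc q * q ^ w                        ≡⟨ cong (16 * suc q *_) (q^≡1+δ w) ⟩
      16 * suc q * suc (δ w)                    ≡⟨ cong (λ x → 16 * suc q * suc x) δw≡7+b ⟨
      16 * suc q * (8 + b)                      ≤⟨ m≤m+n _ _ ⟩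
      16 * suc q * (8 + b) + remainder          ≡⟨ expand p b ⟩
      15 * (q * q) * (7 + b)                    ≡⟨ cong (15 * (q * q) *_) δw≡7+b ⟩
      15 * (q * q) * δ w                        ∎
    where
    open ≤-Reasoning
    7≤δw : 7 ≤ δ w
    7≤δw = ≤-pred (subst (8 ≤_) (q^≡1+δ w) (≤-trans (^-monoˡ-≤ 3 (s≤s (s≤s (z≤n {p})))) (^-monoʳ-≤ q 3≤w)))
    b = δ w ∸ 7
    δw≡7+b : 7 + b ≡ δ w
    δw≡7+b = m+[n∸m]≡n 7≤δw
    remainder = 15 * p * p * b + 44 * p * b + 12 * b + 105 * p * p + 292 * p + 36
    expand : ∀ p b → 16 * (3 + p) * (8 + b) + (15 * p * p * b + 44 * p * b + 12 * b + 105 * p * p + 292 * p + 36)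
                     ≡ 15 * ((2 + p) * (2 + p)) * (7 + b)
    expand = solve-∀

  δ-bound-q[s,1][m,s-1] : ∀ {m s'} → 3 + s' ≤ m →
    16 * q * suc q * δ m * δ (suc s') ≤ 15 * q ^ suc (suc s') * δ (suc (suc s')) * δ (m ∸ s')
  δ-bound-q[s,1][m,s-1] {m} {s'} 3+s'≤m = begin
      16 * q * suc q * δ m * δ (suc s')
    ≡⟨ reorder q (suc q) (δ m) (δ (suc s')) ⟩
      16 * suc q * δ m * (q * δ (suc s'))
    ≤⟨ *-mono-≤ (*-monoʳ-≤ (16 * suc q) (m∸n≤m (q ^ m) 1)) (q*δ≤δ-suc (suc s')) ⟩
      16 * suc q * q ^ m * δ (suc (suc s'))
    ≡⟨ cong (λ x → 16 * suc q * x * δ (suc (suc s'))) q^m≡q^s'*q^w ⟩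
      16 * suc q * (q ^ s' * q ^ w) * δ (suc (suc s'))
    ≡⟨ reorder′ (16 * suc q) (q ^ s') (q ^ w) (δ (suc (suc s'))) ⟩
      q ^ s' * (16 * suc q * q ^ w) * δ (suc (suc s'))
    ≤⟨ *-monoˡ-≤ (δ (suc (suc s'))) (*-monoʳ-≤ (q ^ s') (16[1+q]q^w≤15q²δw 3≤w)) ⟩
      q ^ s' * (15 * (q * q) * δ w) * δ (suc (suc s'))
    ≡⟨ collect q (q ^ s') (δ w) (δ (suc (suc s'))) ⟩
      15 * (q * (q * q ^ s')) * δ (suc (suc s')) * δ w
    ∎
    where
    open ≤-Reasoning
    w = m ∸ s'
    3≤w : 3 ≤ w
    3≤w = m+n≤o⇒m≤o∸n 3 3+s'≤m
    q^m≡q^s'*q^w : q ^ m ≡ q ^ s' * q ^ w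
    q^m≡q^s'*q^w = trans (cong (q ^_) (sym (m+[n∸m]≡n (≤-trans (m≤n+m s' 3) 3+s'≤m)))) (^-distribˡ-+-* q s' w)
    reorder : ∀ c d x y → 16 * c * d * x * y ≡ 16 * d * x * (c * y)
    reorder = solve-∀
    reorder′ : ∀ a b c d → a * (b * c) * d ≡ b * (a * c) * d
    reorder′ = solve-∀
    collect : ∀ c a x y → a * (15 * (c * c) * x) * y ≡ 15 * (c * (c * a)) * y * x
    collect = solve-∀

  bound-q[s,1][m,s-1] : ∀ {m s'} → 3 + s' ≤ m →
    16 * (qbin m 1 * (q * qbin (suc s') 1 * qbin m s')) ≤ 15 * (q ^ suc (suc s') * qbin (suc (suc s')) 2 * qbin m (suc s'))
  bound-q[s,1][m,s-1] {m} {s'} 3+s'≤m = *-cancelʳ-≤ _ _ K {{>-nonZero 0<K}} (begin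
      16 * (qbin m 1 * (q * qbin s 1 * D)) * K
    ≡⟨ spread q (qbin m 1) (qbin s 1) D (δ s) (δ 1) (δ 2) ⟩
      16 * q * (qbin m 1 * δ 1) * (qbin s 1 * δ 2) * D * δ s
    ≡⟨ cong₂ (λ x y → 16 * q * x * y * D * δ s) (qbin-1*δ1 m) [s,1]δ2≡[1+q]δs ⟩
      16 * q * δ m * (suc q * δ s) * D * δ s
    ≡⟨ regroup q (δ m) (δ s) D ⟩
      16 * q * suc q * δ m * δ s * (D * δ s)
    ≤⟨ *-monoˡ-≤ (D * δ s) (δ-bound-q[s,1][m,s-1] 3+s'≤m) ⟩
      15 * Q * δ (suc s) * δ (m ∸ s') * (D * δ s)
    ≡⟨ cong (λ x → 15 * Q * x * δ (m ∸ s') * (D * δ s)) (qbin-1*δ1 (suc s)) ⟨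
      15 * Q * (qbin (suc s) 1 * δ 1) * δ (m ∸ s') * (D * δ s)
    ≡⟨ shuffle Q (qbin (suc s) 1) (δ 1) (δ (m ∸ s')) D (δ s) ⟩
      15 * Q * (qbin (suc s) 1 * δ s) * δ 1 * (D * δ (m ∸ s'))
    ≡⟨ cong₂ (λ x y → 15 * Q * x * δ 1 * y) (qbin-absorb (suc s) 1) (qbin-absorb m s') ⟨
      15 * Q * (E * δ 2) * δ 1 * (C * δ s)
    ≡⟨ gather Q E C (δ s) (δ 1) (δ 2) ⟩
      15 * (Q * E * C) * K
    ∎)
    where
    open ≤-Reasoning
    s = suc s'
    Q = q ^ suc s
    D = qbin m s'
    C = qbin m s
    E = qbin (suc s) 2
    K = δ s * δ 2 * δ 1
    0<K : 0 < K
    0<K = *-mono-< (*-mono-< (0<δ-suc s') (0<δ-suc 1)) (0<δ-suc 0)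
    [s,1]δ2≡[1+q]δs : qbin s 1 * δ 2 ≡ suc q * δ s
    [s,1]δ2≡[1+q]δs = begin-equality
      qbin s 1 * δ 2            ≡⟨ cong (qbin s 1 *_) δ2≡[1+q]*δ1 ⟩
      qbin s 1 * (suc q * δ 1)  ≡⟨ x∙yz≈y∙xz (qbin s 1) (suc q) (δ 1) ⟩
      suc q * (qbin s 1 * δ 1)  ≡⟨ cong (suc q *_) (qbin-1*δ1 s) ⟩
      suc q * δ s               ∎
    spread : ∀ c n₁ n₂ d x y z → 16 * (n₁ * (c * n₂ * d)) * (x * z * y) ≡ 16 * c * (n₁ * y) * (n₂ * z) * d * x
    spread = solve-∀
    regroup : ∀ c a x d → 16 * c * a * (suc c * x) * d * x ≡ 16 * c * suc c * a * x * (d * x)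
    regroup = solve-∀
    shuffle : ∀ c n y u d x → 15 * c * (n * y) * u * (d * x) ≡ 15 * c * (n * x) * y * (d * u)
    shuffle = solve-∀
    gather : ∀ c e a x y z → 15 * c * (e * z) * y * (a * x) ≡ 15 * (c * e * a) * (x * z * y)
    gather = solve-∀

  16[t,1]δ2<δ : ∀ {t u} → 6 + t ≤ u → 16 * qbin t 1 * δ 2 < δ u
  16[t,1]δ2<δ {t} {u} 6+t≤u = begin-strict
      16 * qbin t 1 * δ 2           ≤⟨ *-monoˡ-≤ (δ 2) (*-monoʳ-≤ 16 (qbin-1≤δ t)) ⟩
      16 * δ t * δ 2                ≤⟨ *-mono-≤ (*-monoˡ-≤ (δ t) 16≤q⁴) (m∸n≤m (q ^ 2) 1) ⟩
      q ^ 4 * δ t * q ^ 2           ≡⟨ xy∙z≈xz∙y (q ^ 4) (δ t) (q ^ 2) ⟩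
      q ^ 4 * q ^ 2 * δ t           ≡⟨ cong (_* δ t) (^-distribˡ-+-* q 4 2) ⟨
      q ^ 6 * δ t                   ≤⟨ *-monoˡ-≤ (δ t) (^-monoʳ-≤ q (m+n≤o⇒m≤o∸n 6 6+t≤u)) ⟩
      q ^ (u ∸ t) * δ t             <⟨ m<m+n (q ^ (u ∸ t) * δ t) 0<δ[u∸t] ⟩
      q ^ (u ∸ t) * δ t + δ (u ∸ t) ≡⟨ δ-+ (u ∸ t) t ⟨
      δ (u ∸ t + t)                 ≡⟨ cong δ (m∸n+n≡m (≤-trans (m≤n+m t 6) 6+t≤u)) ⟩
      δ u                           ∎
    where
    open ≤-Reasoning
    16≤q⁴ : 16 ≤ q ^ 4
    16≤q⁴ = ^-monoˡ-≤ 4 (s≤s (s≤s (z≤n {p})))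
    0<δ[u∸t] : 0 < δ (u ∸ t)
    0<δ[u∸t] = <-≤-trans (0<δ-suc 0) (δ-mono (≤-trans (s≤s z≤n) (m+n≤o⇒m≤o∸n 6 6+t≤u)))

  bound-[s+1,1]q^[s+1][t,1] : ∀ {m s' t} → 1 ≤ s' → 7 + t ≤ m → suc s' + suc s' ≤ suc m →
    16 * (qbin m 1 * (qbin (suc (suc s')) 1 * q ^ suc (suc s') * qbin t 1)) < q ^ suc (suc s') * qbin (suc (suc s')) 2 * qbin m (suc s')
  bound-[s+1,1]q^[s+1][t,1] {m} {s'} {t} 1≤s' 7+t≤m 2s≤1+m = *-cancelʳ-< (δ 2 * δ 2) _ _ (begin-strict
      16 * (Nm * (N₁ * Q * Nt)) * (δ 2 * δ 2)   ≡⟨ reorder Nm N₁ Q Nt (δ 2) ⟩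
      A * (16 * Nt * δ 2) * δ 2                 ≤⟨ *-monoʳ-≤ (A * (16 * Nt * δ 2)) (δ-mono (s≤s 1≤s')) ⟩
      A * (16 * Nt * δ 2) * δ s                 <⟨ *-monoˡ-< (δ s) {{>-nonZero (0<δ-suc s')}}
                                                     (*-monoʳ-< A {{>-nonZero 0<A}} (16[t,1]δ2<δ (∸-monoˡ-≤ 1 7+t≤m))) ⟩
      A * δ (m ∸ 1) * δ s                       ≡⟨ regroup Q N₁ Nm (δ (m ∸ 1)) (δ s) ⟩
      Q * (N₁ * δ s) * (Nm * δ (m ∸ 1))          ≡⟨ cong₂ (λ x y → Q * x * y) (qbin-absorb (suc s) 1) (qbin-absorb m 1) ⟨
      Q * (E * δ 2) * (qbin m 2 * δ 2)           ≤⟨ *-monoʳ-≤ (Q * (E * δ 2)) (*-monoˡ-≤ (δ 2) (qbin-monoʳ-≤ (s≤s 1≤s') 2s≤1+m)) ⟩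
      Q * (E * δ 2) * (C * δ 2)                  ≡⟨ gather Q E C (δ 2) ⟩
      Q * E * C * (δ 2 * δ 2)                    ∎)
    where
    open ≤-Reasoning
    s = suc s'
    Q = q ^ suc s
    Nm = qbin m 1
    N₁ = qbin (suc s) 1
    Nt = qbin t 1
    E = qbin (suc s) 2
    C = qbin m s
    A = Q * N₁ * Nm
    0<A : 0 < A
    0<A = *-mono-< (*-mono-< (m^n>0 q (suc s)) (0<qbin {suc s} (s≤s z≤n))) (0<qbin {m} (≤-trans (s≤s z≤n) 7+t≤m))
    reorder : ∀ n₁ n₂ c n₃ x → 16 * (n₁ * (n₂ * c * n₃)) * (x * x) ≡ c * n₂ * n₁ * (16 * n₃ * x) * x
    reorder = solve-∀
    regroup : ∀ c n₁ n₂ x y → c * n₁ * n₂ * x * y ≡ c * (n₁ * y) * (n₂ * x)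
    regroup = solve-∀
    gather : ∀ c e a x → c * (e * x) * (a * x) ≡ c * e * a * (x * x)
    gather = solve-∀

  [m,1]*correction<main : ∀ {m s' t} → 1 ≤ s' → 3 + s' ≤ m → 7 + t ≤ m → suc s' + suc s' ≤ suc m →
    qbin m 1 * (q * qbin (suc s') 1 * qbin m s' + qbin (suc (suc s')) 1 * q ^ suc (suc s') * qbin t 1)
      < q ^ suc (suc s') * qbin (suc (suc s')) 2 * qbin m (suc s')
  [m,1]*correction<main {m} {s'} {t} 1≤s' 3+s'≤m 7+t≤m 2s≤1+m = *-cancelˡ-< 16 _ _ (begin-strict
      16 * (qbin m 1 * (x + y))             ≡⟨ cong (16 *_) (*-distribˡ-+ (qbin m 1) x y) ⟩
      16 * (qbin m 1 * x + qbin m 1 * y)    ≡⟨ *-distribˡ-+ 16 (qbin m 1 * x) (qbin m 1 * y) ⟩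
      16 * (qbin m 1 * x) + 16 * (qbin m 1 * y)
        <⟨ +-mono-≤-< (bound-q[s,1][m,s-1] 3+s'≤m) (bound-[s+1,1]q^[s+1][t,1] 1≤s' 7+t≤m 2s≤1+m) ⟩
      15 * M + M                            ≡⟨ +-comm (15 * M) M ⟩
      16 * M                                ∎)
    where
    open ≤-Reasoning
    x = q * qbin (suc s') 1 * qbin m s'
    y = qbin (suc (suc s')) 1 * q ^ suc (suc s') * qbin t 1
    M = q ^ suc (suc s') * qbin (suc (suc s')) 2 * qbin m (suc s')

  g5g2<g3ᴺ : ∀ {s' j' r t} → 1 ≤ s' → suc s' ≤ t → j' < r → 5 + t ≤ r →
    qbin (suc (suc s')) 1 * qbin (suc s' + r) (suc j') * (qbin (suc (suc s' + r)) (suc s') + q ^ suc (suc s') * qbin t 1)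
      < qbin (suc s' + r) (suc j') * (q ^ suc s' * qbin (t + 1) 1 * qbin (suc s' + r) (suc s') + qbin (suc s' + r) s')
        + q ^ (s' * j' + 1) * qbin r j' * qbin (suc (suc s')) 2 * (qbin (suc (suc s' + r)) (suc s') + q ^ suc (suc s') * qbin t 1)
  g5g2<g3ᴺ {s'} {j'} {r} {t} 1≤s' s<t j'<r 5+t≤r = begin-strict
      N₁ * B * (D + u * C + Q * Nt)
    ≡⟨ split (q * Ns) B D u C Q Nt (qbin-suc-1 s) ⟩
      B * D + B * (N₁ * u * C) + B * W
    ≤⟨ +-monoˡ-≤ (B * W) (+-monoʳ-≤ (B * D) (*-monoʳ-≤ B (*-monoˡ-≤ C (*-monoˡ-≤ u (qbin-1-mono 2+s'≤t+1))))) ⟩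
      B * D + B * (Nt₁ * u * C) + B * W
    <⟨ +-monoʳ-< (B * D + B * (Nt₁ * u * C)) B*W<X*uC ⟩
      B * D + B * (Nt₁ * u * C) + X * (u * C)
    ≤⟨ +-mono-≤ (≤-reflexive (collect B u Nt₁ C D)) (*-monoʳ-≤ X (≤-trans (m≤n+m (u * C) D) (m≤m+n (D + u * C) (Q * Nt)))) ⟩
      B * (u * Nt₁ * C + D) + X * (D + u * C + Q * Nt)
    ∎
    where
    open ≤-Reasoning
    s = suc s'
    m = s + r
    N₁ = qbin (suc s) 1
    Ns = qbin s 1
    Nt = qbin t 1
    Nt₁ = qbin (t + 1) 1
    B = qbin m (suc j')
    D = qbin m s'
    C = qbin m s
    E = qbin (suc s) 2
    Y = qbin r j'
    u = q ^ s
    Q = q ^ suc s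
    X = q ^ (s' * j' + 1) * Y * E
    W = q * Ns * D + N₁ * Q * Nt
    s'≤r : s' ≤ r
    s'≤r = ≤-trans (<⇒≤ s<t) (≤-trans (m≤n+m t 5) 5+t≤r)
    2+s'≤t+1 : suc s ≤ t + 1
    2+s'≤t+1 = subst (suc s ≤_) (+-comm 1 t) (s≤s s<t)
    3+s'≤m : 3 + s' ≤ m
    3+s'≤m = s≤s (subst (_≤ s' + r) (+-comm s' 2) (+-monoʳ-≤ s' (≤-trans (s≤s (s≤s z≤n)) 5+t≤r)))
    7+t≤m : 7 + t ≤ m
    7+t≤m = +-mono-≤ (s≤s 1≤s') 5+t≤r
    2s≤1+m : s + s ≤ suc m
    2s≤1+m = s≤s (subst (_≤ suc (s' + r)) (sym (+-suc s' s')) (s≤s (+-monoʳ-≤ s' s'≤r)))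
    B*W<X*uC : B * W < X * (u * C)
    B*W<X*uC = begin-strict
      B * W                              ≤⟨ *-monoˡ-≤ W (qbin-+≤ s' r j' j'<r) ⟩
      q ^ (s' * j') * Y * qbin m 1 * W   ≡⟨ *-assoc (q ^ (s' * j') * Y) (qbin m 1) W ⟩
      q ^ (s' * j') * Y * (qbin m 1 * W) <⟨ *-monoʳ-< (q ^ (s' * j') * Y) {{>-nonZero 0<q^Y}}
                                               ([m,1]*correction<main 1≤s' 3+s'≤m 7+t≤m 2s≤1+m) ⟩
      q ^ (s' * j') * Y * (Q * E * C)    ≡⟨ move-q q (q ^ (s' * j')) Y E u C ⟩
      q ^ (s' * j') * (q * 1) * Y * E * (u * C)
                                         ≡⟨ cong (λ x → x * Y * E * (u * C)) (^-distribˡ-+-* q (s' * j') 1) ⟨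
      X * (u * C)                        ∎
      where
      0<q^Y : 0 < q ^ (s' * j') * Y
      0<q^Y = *-mono-< (m^n>0 q (s' * j')) (0<qbin (<⇒≤ j'<r))
      move-q : ∀ c a y e u x → a * y * (c * u * e * x) ≡ a * (c * 1) * y * e * (u * x)
      move-q = solve-∀
    split : ∀ {n₁} n b d u c g k → n₁ ≡ suc n →
      n₁ * b * (d + u * c + g * k) ≡ b * d + b * (n₁ * u * c) + b * (n * d + n₁ * g * k)
    split n b d u c g k refl = expand n b d u c g k
      where
      expand : ∀ n b d u c g k →
        suc n * b * (d + u * c + g * k) ≡ b * d + b * (suc n * u * c) + b * (n * d + suc n * g * k)
      expand = solve-∀
    collect : ∀ b u n c d → b * d + b * (n * u * c) ≡ b * (u * n * c + d)
    collect = solve-∀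

open Gaussian using (qbin; gauss≡qbin; g5g2<g3ᴺ)

G5G2<G3 : (q n k₁ k₂ t : ℕ) → Set
G5G2<G3 q n k₁ k₂ t =
    ((+ (gauss q (k₂ ∸ t + 1) 1 * gauss q (n ∸ t ∸ 1) (k₁ ∸ t ∸ 1)))
      - (+ (q ^ ((k₂ ∸ t ∸ 1) * (k₁ ∸ t ∸ 2) + 1) * gauss q (n ∸ k₂ ∸ 1) (k₁ ∸ t ∸ 2) * gauss q (k₂ + 1 ∸ t) 2)))
    *ℤ (+ (gauss q (n ∸ t) (k₂ ∸ t) + q ^ (k₂ + 1 ∸ t) * gauss q t 1))
    <ℤ + (gauss q (n ∸ t ∸ 1) (k₁ ∸ t ∸ 1)
          * (q ^ (k₂ ∸ t) * gauss q (t + 1) 1 * gauss q (n ∸ t ∸ 1) (k₂ ∸ t) + gauss q (n ∸ t ∸ 1) (k₂ ∸ t ∸ 1)))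

g5g2<g3-reindexed : ∀ {q n k₁ k₂ t s' j' r} → 1 < q →
  k₂ ∸ t ≡ suc s' → n ∸ t ≡ suc (suc s' + r) → k₁ ∸ t ≡ suc (suc j') → n ∸ k₂ ≡ suc r → k₂ + 1 ∸ t ≡ suc s' + 1 →
  1 ≤ s' → suc s' ≤ t → j' < r → 5 + t ≤ r → G5G2<G3 q n k₁ k₂ t
g5g2<g3-reindexed {t = t} {s'} {j'} {r} (s≤s (s≤s (z≤n {p}))) e₁ e₂ e₃ e₄ e₅ 1≤s' s<t j'<r 5+t≤r
  rewrite e₁ | e₂ | e₃ | e₄ | e₅ | +-comm s' 1
        | gauss≡qbin p (suc (suc s')) 1 | gauss≡qbin p (suc (suc s')) 2 | gauss≡qbin p (suc s' + r) (suc j') | gauss≡qbin p r j'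
        | gauss≡qbin p (suc (suc s' + r)) (suc s') | gauss≡qbin p t 1 | gauss≡qbin p (t + 1) 1
        | gauss≡qbin p (suc s' + r) (suc s') | gauss≡qbin p (suc s' + r) s'
  = +a-+b*+g<+c {b = (2 + p) ^ (s' * j' + 1) * qbin p r j' * qbin p (suc (suc s')) 2} (g5g2<g3ᴺ p 1≤s' s<t j'<r 5+t≤r)

g5g2<g3 : ∀ {q n k₁ k₂ t} → 1 < q → 1 ≤ t → k₁ + k₂ + t + 3 ≤ n → k₂ ≤ k₁ → t + 2 ≤ k₂ → k₂ ≤ 2 * t →
  G5G2<G3 q n k₁ k₂ t
g5g2<g3 {q} {n} {k₁} {k₂} {t} 1<q 1≤t n-large k₂≤k₁ t+2≤k₂ k₂≤2t =
  g5g2<g3-reindexed 1<q k₂∸t≡1+s' n∸t≡2+s'+r k₁∸t≡2+j' n∸k₂≡1+r k₂+1∸t≡1+s'+1 1≤s' 1+s'≤t j'<r 5+t≤r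
  where
  s' = k₂ ∸ suc t
  j' = k₁ ∸ suc (suc t)
  r = n ∸ suc k₂
  2+t≤k₂ : 2 + t ≤ k₂
  2+t≤k₂ = subst (_≤ k₂) (+-comm t 2) t+2≤k₂
  2+t≤k₁ : 2 + t ≤ k₁
  2+t≤k₁ = ≤-trans 2+t≤k₂ k₂≤k₁
  k₁+t+2+[1+k₂]≤n : k₁ + t + 2 + suc k₂ ≤ n
  k₁+t+2+[1+k₂]≤n = subst (_≤ n) (rearrange k₁ k₂ t) n-large
    where
    rearrange : ∀ a b c → a + b + c + 3 ≡ a + c + 2 + suc b
    rearrange = solve-∀
  k₁+t+2≤r : k₁ + t + 2 ≤ r
  k₁+t+2≤r = m+n≤o⇒m≤o∸n (k₁ + t + 2) k₁+t+2+[1+k₂]≤n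
  k₂∸t≡1+s' : k₂ ∸ t ≡ suc s'
  k₂∸t≡1+s' = m<n⇒n∸m≡1+[n∸1+m] (≤-trans (n≤1+n _) 2+t≤k₂)
  k₁∸t≡2+j' : k₁ ∸ t ≡ suc (suc j')
  k₁∸t≡2+j' = trans (m<n⇒n∸m≡1+[n∸1+m] (≤-trans (n≤1+n _) 2+t≤k₁)) (cong suc (m<n⇒n∸m≡1+[n∸1+m] 2+t≤k₁))
  k₂<n : k₂ < n
  k₂<n = ≤-trans (m≤n+m (suc k₂) (k₁ + t + 2)) k₁+t+2+[1+k₂]≤n
  n∸k₂≡1+r : n ∸ k₂ ≡ suc r
  n∸k₂≡1+r = m<n⇒n∸m≡1+[n∸1+m] k₂<n
  n∸t≡2+s'+r : n ∸ t ≡ suc (suc s' + r)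
  n∸t≡2+s'+r = begin
    n ∸ t                   ≡⟨ cong (_∸ t) (m∸n+n≡m (<⇒≤ k₂<n)) ⟨
    (n ∸ k₂ + k₂) ∸ t       ≡⟨ +-∸-assoc (n ∸ k₂) t≤k₂ ⟩
    (n ∸ k₂) + (k₂ ∸ t)     ≡⟨ cong₂ _+_ n∸k₂≡1+r k₂∸t≡1+s' ⟩
    suc r + suc s'          ≡⟨ cong suc (+-comm r (suc s')) ⟩
    suc (suc s' + r)        ∎
    where
    open ≡-Reasoning
    t≤k₂ = ≤-trans (m≤n+m t 2) 2+t≤k₂
  k₂+1∸t≡1+s'+1 : k₂ + 1 ∸ t ≡ suc s' + 1
  k₂+1∸t≡1+s'+1 = trans (+-∸-comm 1 (≤-trans (m≤n+m t 2) 2+t≤k₂)) (cong (_+ 1) k₂∸t≡1+s')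
  1≤s' : 1 ≤ s'
  1≤s' = m+n≤o⇒m≤o∸n 1 2+t≤k₂
  1+s'≤t : suc s' ≤ t
  1+s'≤t = subst (_≤ t) k₂∸t≡1+s' (m≤n+o⇒m∸n≤o k₂ t (subst (k₂ ≤_) (cong (λ x → t + x) (+-identityʳ t)) k₂≤2t))
  j'<r : j' < r
  j'<r = ≤-trans (s≤s (m∸n≤m k₁ (2 + t))) (≤-trans (≤-trans (s≤s (m≤m+n k₁ t)) (m<m+n (k₁ + t) (s≤s z≤n))) k₁+t+2≤r)
  5+t≤r : 5 + t ≤ r
  5+t≤r = ≤-trans (subst (_≤ k₁ + t + 2) (cong (λ x → 3 + x) (+-comm t 2)) (+-monoˡ-≤ 2 (+-monoˡ-≤ t 3≤k₁))) k₁+t+2≤r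
    where
    3≤k₁ : 3 ≤ k₁
    3≤k₁ = ≤-trans (+-monoʳ-≤ 2 1≤t) 2+t≤k₁

IsPrimePower⇒1< : ∀ {q} → IsPrimePower q → 1 < q
IsPrimePower⇒1< (p , m , p-prime , refl) =
  ≤-trans (nonTrivial⇒n>1 p {{prime⇒nonTrivial p-prime}}) (m≤m*n p (p ^ m) {{m^n≢0 p m {{prime⇒nonZero p-prime}}}})

lemma5p3 : (q n k₁ k₂ t : ℕ) → IsPrimePower q → 1 ≤ n → 1 ≤ k₁ → 1 ≤ k₂ → 1 ≤ t →
    k₁ + k₂ + t + 3 ≤ n → k₂ ≤ k₁ → t + 1 ≤ k₂ → t + 2 ≤ k₂ → k₂ ≤ 2 * t →
    ((+ (gauss q (k₂ ∸ t + 1) 1 * gauss q (n ∸ t ∸ 1) (k₁ ∸ t ∸ 1)))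
      - (+ (q ^ ((k₂ ∸ t ∸ 1) * (k₁ ∸ t ∸ 2) + 1) * gauss q (n ∸ k₂ ∸ 1) (k₁ ∸ t ∸ 2) * gauss q (k₂ + 1 ∸ t) 2)))
    *ℤ (+ (gauss q (n ∸ t) (k₂ ∸ t) + q ^ (k₂ + 1 ∸ t) * gauss q t 1))
    <ℤ + (gauss q (n ∸ t ∸ 1) (k₁ ∸ t ∸ 1)
          * (q ^ (k₂ ∸ t) * gauss q (t + 1) 1 * gauss q (n ∸ t ∸ 1) (k₂ ∸ t) + gauss q (n ∸ t ∸ 1) (k₂ ∸ t ∸ 1)))
lemma5p3 q n k₁ k₂ t q-pp _ _ _ 1≤t n-large k₂≤k₁ _ t+2≤k₂ k₂≤2t =
  g5g2<g3 (IsPrimePower⇒1< q-pp) 1≤t n-large k₂≤k₁ t+2≤k₂ k₂≤2t
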